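{- As $n\to\infty$, \[\tfrac{n^2}{6}+O(n)\le\mathrm{sat}_\circlearrowright(n,D_1)\le\tfrac{n^2}{4}+O(n).\]
   Context: $\Omega_n=\{v_0,\dots,v_{n-1}\}$ carries the cyclic order $v_0<\dots<v_{n-1}<v_0$. A $3$-cgh on $\Omega_n$ is a set $H\subseteq\binom{\Omega_n}{3}$. For a cgh $F$ on a cyclically ordered set $U$, $H$ contains a copy of $F$ if there is an injection $U\to\Omega_n$ preserving the cyclic order and mapping every edge of $F$ onto an edge of $H$; $H$ is $F$-saturated if it contains no copy of $F$ but $H\cup\{e\}$ does for every $e\in\binom{\Omega_n}{3}\setminus H$. $\mathrm{sat}_\circlearrowright(n,F)$ is the minimum number of edges of an $F$-saturated $3$-cgh on $\Omega_n$. $D_1$ is the $3$-cgh on cyclically ordered points $u_0<u_1<u_2<u_3<u_0$ with edges $\{u_0,u_1,u_2\}$ and $\{u_0,u_2,u_3\}$. -}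

module Defs where

open import Data.Nat using (ℕ; zero; suc; _+_; _*_; _≤_)
open import Data.Bool using (Bool; true; false; _∧_; _∨_; if_then_else_; T)
open import Data.Fin using (Fin; zero; suc; _<_; _≟_)
open import Data.Product using (Σ; _×_; ∃; ∃-syntax)
open import Data.Sum using (_⊎_)
open import Relation.Nullary using (¬_)
open import Relation.Nullary.Decidable using (⌊_⌋)
open import Data.Fin.Properties using (_<?_)
open import Relation.Binary.PropositionalEquality using (_≡_)

u0 u1 u2 u3 : Fin 4
u0 = zero
u1 = suc zero
u2 = suc (suc zero)
u3 = suc (suc (suc zero))

-- Ω_n = Fin n, with v_i = i and the cyclic order 0 < 1 < ... < n-1 < 0.
-- A 3-cgh H on Ω_n is encoded by a Boolean function on triples; only its
-- values on strictly increasing triples (a < b < c) matter: the 3-set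
-- {a,b,c} with a < b < c is an edge iff H a b c ≡ true.
CGH : ℕ → Set
CGH n = Fin n → Fin n → Fin n → Bool

Has : ∀ {n} → CGH n → Fin n → Fin n → Fin n → Set
Has H x y z =
    (x < y × y < z × T (H x y z))
  ⊎ (x < z × z < y × T (H x z y))
  ⊎ (y < x × x < z × T (H y x z))
  ⊎ (y < z × z < x × T (H y z x))
  ⊎ (z < x × x < y × T (H z x y))
  ⊎ (z < y × y < x × T (H z y x))

-- f : {u0,u1,u2,u3} → Ω_n is an injection preserving the cyclic order
-- u0 < u1 < u2 < u3 < u0, i.e. some cyclic rotation of
-- (f u0, f u1, f u2, f u3) is strictly increasing.
CycPres : ∀ {n} → (Fin 4 → Fin n) → Set
CycPres f =
    (f u0 < f u1 × f u1 < f u2 × f u2 < f u3)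
  ⊎ (f u1 < f u2 × f u2 < f u3 × f u3 < f u0)
  ⊎ (f u2 < f u3 × f u3 < f u0 × f u0 < f u1)
  ⊎ (f u3 < f u0 × f u0 < f u1 × f u1 < f u2)

ContainsD1 : ∀ {n} → CGH n → Set
ContainsD1 {n} H = ∃[ f ] (CycPres {n} f × Has H (f u0) (f u1) (f u2) × Has H (f u0) (f u2) (f u3))

addEdge : ∀ {n} → CGH n → Fin n → Fin n → Fin n → CGH n
addEdge H a b c x y z = H x y z ∨ (⌊ x ≟ a ⌋ ∧ ⌊ y ≟ b ⌋ ∧ ⌊ z ≟ c ⌋)

D1Saturated : ∀ {n} → CGH n → Set
D1Saturated {n} H =
  ¬ ContainsD1 H ×
  (∀ (a b c : Fin n) → a < b → b < c → H a b c ≡ false → ContainsD1 (addEdge H a b c))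

sumFin : ∀ {n} → (Fin n → ℕ) → ℕ
sumFin {zero} g = 0
sumFin {suc n} g = g zero + sumFin (λ i → g (suc i))

edgeCount : ∀ {n} → CGH n → ℕ
edgeCount H = sumFin λ a → sumFin λ b → sumFin λ c →
  if ⌊ a <? b ⌋ ∧ ⌊ b <? c ⌋ ∧ H a b c then 1 else 0

IsSatD1 : ℕ → ℕ → Set
IsSatD1 n m = (Σ (CGH n) λ H → D1Saturated H × edgeCount H ≡ m)
            × (∀ (H : CGH n) → D1Saturated H → m ≤ edgeCount H)

{-# OPTIONS --safe #-}
module Submission where

-- Lower bound: if H is D1-saturated, adding a non-edge abc creates a copy of D1, whose
-- other edge e lies in H; so abc is the D1-partner of e inside e ∪ {w} for some vertex w.
-- Since e and w determine the partner, there are at most n·|H| non-edges, and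
-- C(n,3) ≤ (n + 1)|H| gives n² ≤ 6|H| + 4n.
-- Upper bound: the edges {2i, 2i+1, c} with 2i + 1 < c form a D1-saturated 3-cgh with
-- at most n²/4 edges.  The minimum sat(n, D1) exists because the 3-cghs on Ω_n can be
-- searched exhaustively.

open import Algebra.Properties.CommutativeSemigroup using (interchange)
open import Data.Bool as Bool using (Bool; true; false; _∧_; _∨_; T; not; if_then_else_)
open import Data.Bool.Properties using (T-≡; T-∧; T-∨; T-not-≡; ∨-zeroʳ; ∧-zeroʳ; ∧-identityʳ)
open import Data.Empty using (⊥-elim)
open import Data.Fin as Fin using (Fin; zero; suc; toℕ; _<_; _≟_)
open import Data.Fin.Properties
  using (any?; all?; _<?_; <-trans; <-asym; <-irrefl; suc-injective; toℕ-fromℕ<; toℕ<n)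
open import Data.Nat as ℕ using (ℕ; zero; suc; _+_; _*_; _≤_; _<ᵇ_; z≤n; s≤s)
open import Data.Nat.Properties as ℕ
  using ( ≤-refl; ≤-trans; ≤-reflexive; +-mono-≤; *-monoʳ-≤; *-cancelʳ-≤; m≤m+n; m≤n+m; n<1+n; <⇒<ᵇ
        ; +-identityʳ; *-zeroʳ; *-identityʳ; *-distribˡ-+; +-commutativeSemigroup; module ≤-Reasoning)
open import Data.Nat.Tactic.RingSolver using (solve-∀)
open import Data.Product using (Σ; _×_; _,_; proj₁; proj₂; ∃; ∃-syntax)
open import Data.Sum as Sum using (_⊎_; inj₁; inj₂)
open import Data.Unit using (tt)
open import Data.Vec.Functional using (_∷_; []; head; tail)
open import Data.Vec.Functional.Relation.Binary.Pointwise using (Pointwise)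
import Data.Vec.Functional.Relation.Binary.Pointwise.Properties as Pointwise
open import Function using (_∘_)
open import Function.Bundles using (Equivalence)
open import Level using (0ℓ)
open import Relation.Binary.Bundles using (Setoid)
open import Relation.Binary.Definitions using (_Respects_)
open import Relation.Binary.PropositionalEquality
  using (_≡_; _≗_; refl; sym; trans; cong; cong₂; subst; module ≡-Reasoning)
import Relation.Binary.PropositionalEquality as ≡
open import Relation.Nullary using (¬_; Dec; yes; no)
open import Relation.Nullary.Decidable
  using ( ⌊_⌋; map′; T?; ¬?; _×-dec_; _⊎-dec_; _→-dec_; isYes≗does; dec-true; dec-false; ⌊⌋-map′
        ; toWitness; fromWitness)
open import Relation.Unary as U using (Pred)

open import Defs

sumFin-cong : ∀ {n} {f g : Fin n → ℕ} → f ≗ g → sumFin f ≡ sumFin g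
sumFin-cong {zero}  f≗g = refl
sumFin-cong {suc n} f≗g = cong₂ _+_ (f≗g zero) (sumFin-cong (f≗g ∘ suc))

sumFin-const : ∀ n c → sumFin {n} (λ _ → c) ≡ n * c
sumFin-const zero    c = refl
sumFin-const (suc n) c = cong (c +_) (sumFin-const n c)

sumFin-zero : ∀ {n} {f : Fin n → ℕ} → (∀ i → f i ≡ 0) → sumFin f ≡ 0
sumFin-zero {n} f≡0 = trans (sumFin-cong f≡0) (trans (sumFin-const n 0) (*-zeroʳ n))

sumFin-distrib-+ : ∀ {n} (f g : Fin n → ℕ) → sumFin (λ i → f i + g i) ≡ sumFin f + sumFin g
sumFin-distrib-+ {zero}  f g = refl
sumFin-distrib-+ {suc n} f g =
  trans (cong (f zero + g zero +_) (sumFin-distrib-+ (f ∘ suc) (g ∘ suc)))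
        (interchange +-commutativeSemigroup (f zero) (g zero) _ _)

*-distribˡ-sumFin : ∀ {n} c (f : Fin n → ℕ) → c * sumFin f ≡ sumFin (λ i → c * f i)
*-distribˡ-sumFin {zero}  c f = *-zeroʳ c
*-distribˡ-sumFin {suc n} c f =
  trans (*-distribˡ-+ c (f zero) _) (cong (c * f zero +_) (*-distribˡ-sumFin c (f ∘ suc)))

sumFin-comm : ∀ {m n} (f : Fin m → Fin n → ℕ) →
              sumFin (λ i → sumFin (f i)) ≡ sumFin (λ j → sumFin (λ i → f i j))
sumFin-comm {zero} {n} f = sym (sumFin-zero {n} (λ _ → refl))
sumFin-comm {suc m} f =
  trans (cong (sumFin (f zero) +_) (sumFin-comm (f ∘ suc)))
        (sym (sumFin-distrib-+ (f zero) _))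

sumFin-mono-≤ : ∀ {n} {f g : Fin n → ℕ} → (∀ i → f i ≤ g i) → sumFin f ≤ sumFin g
sumFin-mono-≤ {zero}  f≤g = z≤n
sumFin-mono-≤ {suc n} f≤g = +-mono-≤ (f≤g zero) (sumFin-mono-≤ (f≤g ∘ suc))

≤-sumFin : ∀ {n} (f : Fin n → ℕ) i → f i ≤ sumFin f
≤-sumFin f zero    = m≤m+n _ _
≤-sumFin f (suc i) = ≤-trans (≤-sumFin (f ∘ suc) i) (m≤n+m _ _)

[_] : Bool → ℕ
[ b ] = if b then 1 else 0

[]-T : ∀ {b} → T b → [ b ] ≡ 1
[]-T {true} _ = refl

isYes-true : ∀ {A : Set} (a? : Dec A) → A → ⌊ a? ⌋ ≡ true
isYes-true a? a = trans (isYes≗does a?) (dec-true a? a)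

isYes-false : ∀ {A : Set} (a? : Dec A) → ¬ A → ⌊ a? ⌋ ≡ false
isYes-false a? ¬a = trans (isYes≗does a?) (dec-false a? ¬a)

δ : ∀ {n} → Fin n → Fin n → ℕ
δ i j = [ ⌊ i ≟ j ⌋ ]

δ-refl : ∀ {n} (i : Fin n) → δ i i ≡ 1
δ-refl i = cong [_] (isYes-true (i ≟ i) refl)

sumFin-δ : ∀ {n} (i : Fin n) → sumFin (δ i) ≡ 1
sumFin-δ {suc n} zero    = cong suc (sumFin-zero {n} λ _ → refl)
sumFin-δ {suc n} (suc i) =
  trans (sumFin-cong λ j → cong [_] (⌊⌋-map′ (cong suc) suc-injective (i ≟ j))) (sumFin-δ i)

sumFin-*δ : ∀ {n} k (i : Fin n) → sumFin (λ j → k * δ i j) ≡ k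
sumFin-*δ k i = begin
  sumFin (λ j → k * δ i j) ≡⟨ *-distribˡ-sumFin k (δ i) ⟨
  k * sumFin (δ i)         ≡⟨ cong (k *_) (sumFin-δ i) ⟩
  k * 1                    ≡⟨ *-identityʳ k ⟩
  k                        ∎
  where open ≡-Reasoning

Triple : ℕ → Set
Triple n = Fin n × Fin n × Fin n

module _ {n : ℕ} where

  Σ³ : (Fin n → Fin n → Fin n → ℕ) → ℕ
  Σ³ f = sumFin λ a → sumFin λ b → sumFin λ c → f a b c

  Σ³-cong : {f g : Fin n → Fin n → Fin n → ℕ} → (∀ a b c → f a b c ≡ g a b c) → Σ³ f ≡ Σ³ g
  Σ³-cong f≡g = sumFin-cong λ a → sumFin-cong λ b → sumFin-cong (f≡g a b)

  Σ³-mono-≤ : {f g : Fin n → Fin n → Fin n → ℕ} → (∀ a b c → f a b c ≤ g a b c) → Σ³ f ≤ Σ³ g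
  Σ³-mono-≤ f≤g = sumFin-mono-≤ λ a → sumFin-mono-≤ λ b → sumFin-mono-≤ (f≤g a b)

  Σ³-distrib-+ : (f g : Fin n → Fin n → Fin n → ℕ) →
                 Σ³ (λ a b c → f a b c + g a b c) ≡ Σ³ f + Σ³ g
  Σ³-distrib-+ f g =
    trans (sumFin-cong λ a →
      trans (sumFin-cong λ b → sumFin-distrib-+ (f a b) (g a b))
            (sumFin-distrib-+ (λ b → sumFin (f a b)) (λ b → sumFin (g a b))))
          (sumFin-distrib-+ (λ a → sumFin λ b → sumFin (f a b)) (λ a → sumFin λ b → sumFin (g a b)))

  *-distribˡ-Σ³ : ∀ k (f : Fin n → Fin n → Fin n → ℕ) → k * Σ³ f ≡ Σ³ (λ a b c → k * f a b c)
  *-distribˡ-Σ³ k f =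
    trans (*-distribˡ-sumFin {n} k _) (sumFin-cong λ a →
    trans (*-distribˡ-sumFin {n} k _) (sumFin-cong λ b →
           *-distribˡ-sumFin k (f a b)))

  Σ³-sumFin-comm : ∀ {m} (f : Fin n → Fin n → Fin n → Fin m → ℕ) →
                   Σ³ (λ a b c → sumFin (f a b c)) ≡ sumFin (λ x → Σ³ λ a b c → f a b c x)
  Σ³-sumFin-comm f =
    trans (sumFin-cong λ a →
      trans (sumFin-cong λ b → sumFin-comm (f a b))
            (sumFin-comm λ b x → sumFin λ c → f a b c x))
          (sumFin-comm λ a x → sumFin λ b → sumFin λ c → f a b c x)

  Σ³-comm : (f : Fin n → Fin n → Fin n → Fin n → Fin n → Fin n → ℕ) →
            Σ³ (λ a b c → Σ³ (f a b c)) ≡ Σ³ (λ p q r → Σ³ λ a b c → f a b c p q r)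
  Σ³-comm f =
    trans (Σ³-sumFin-comm {n} _) (sumFin-cong λ p →
    trans (Σ³-sumFin-comm {n} _) (sumFin-cong λ q →
           Σ³-sumFin-comm (λ a b c → f a b c p q)))

  ≤-Σ³ : (f : Fin n → Fin n → Fin n → ℕ) → ∀ a b c → f a b c ≤ Σ³ f
  ≤-Σ³ f a b c =
    ≤-trans (≤-sumFin (f a b) c) (≤-trans (≤-sumFin (λ b → sumFin (f a b)) b)
                                          (≤-sumFin (λ a → sumFin λ b → sumFin (f a b)) a))

  δ³ : Triple n → Fin n → Fin n → Fin n → ℕ
  δ³ (x , y , z) a b c = δ x a * δ y b * δ z c

  Σ³-δ³ : ∀ t → Σ³ (δ³ t) ≡ 1
  Σ³-δ³ (x , y , z) =
    trans (sumFin-cong λ a → trans (sumFin-cong λ b → sumFin-*δ (δ x a * δ y b) z)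
                                   (sumFin-*δ (δ x a) y))
          (sumFin-δ x)

  Σ³-fibres : (u : Fin n → Fin n → Fin n → ℕ) (φ : Fin n → Fin n → Fin n → Fin n → Triple n) →
              Σ³ (λ a b c → Σ³ λ p q r → sumFin λ w → u p q r * δ³ (φ p q r w) a b c) ≡ n * Σ³ u
  Σ³-fibres u φ = begin
    Σ³ (λ a b c → Σ³ λ p q r → sumFin λ w → u p q r * δ³ (φ p q r w) a b c)
      ≡⟨ Σ³-comm _ ⟩
    Σ³ (λ p q r → Σ³ λ a b c → sumFin λ w → u p q r * δ³ (φ p q r w) a b c)
      ≡⟨ Σ³-cong (λ p q r → Σ³-sumFin-comm λ a b c w → u p q r * δ³ (φ p q r w) a b c) ⟩
    Σ³ (λ p q r → sumFin λ w → Σ³ λ a b c → u p q r * δ³ (φ p q r w) a b c)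
      ≡⟨ Σ³-cong (λ p q r → sumFin-cong {n} (fibre p q r)) ⟩
    Σ³ (λ p q r → sumFin {n} λ _ → u p q r)
      ≡⟨ Σ³-cong (λ p q r → sumFin-const n (u p q r)) ⟩
    Σ³ (λ p q r → n * u p q r)
      ≡⟨ *-distribˡ-Σ³ n u ⟨
    n * Σ³ u ∎
    where
    open ≡-Reasoning
    fibre : ∀ p q r w → Σ³ (λ a b c → u p q r * δ³ (φ p q r w) a b c) ≡ u p q r
    fibre p q r w = begin
      Σ³ (λ a b c → u p q r * δ³ (φ p q r w) a b c) ≡⟨ *-distribˡ-Σ³ (u p q r) _ ⟨
      u p q r * Σ³ (δ³ (φ p q r w))                 ≡⟨ cong (u p q r *_) (Σ³-δ³ (φ p q r w)) ⟩
      u p q r * 1                                   ≡⟨ *-identityʳ _ ⟩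
      u p q r                                       ∎

  Σ³-covered-≤ : (P Q : Fin n → Fin n → Fin n → Bool) (φ : Fin n → Fin n → Fin n → Fin n → Triple n) →
                 (∀ a b c → T (P a b c) →
                   ∃[ p ] ∃[ q ] ∃[ r ] ∃[ w ] T (Q p q r) × φ p q r w ≡ (a , b , c)) →
                 Σ³ (λ a b c → [ P a b c ]) ≤ n * Σ³ (λ a b c → [ Q a b c ])
  Σ³-covered-≤ P Q φ cover =
    ≤-trans (Σ³-mono-≤ covered) (≤-reflexive (Σ³-fibres (λ a b c → [ Q a b c ]) φ))
    where
    term : Fin n → Fin n → Fin n → Fin n → Fin n → Fin n → Fin n → ℕ
    term a b c p q r w = [ Q p q r ] * δ³ (φ p q r w) a b c

    count : Fin n → Fin n → Fin n → ℕ
    count a b c = Σ³ λ p q r → sumFin (term a b c p q r)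

    counted : ∀ {a b c} → ∃[ p ] ∃[ q ] ∃[ r ] ∃[ w ] T (Q p q r) × φ p q r w ≡ (a , b , c) →
              1 ≤ count a b c
    counted {a} {b} {c} (p , q , r , w , Qpqr , φ≡abc) =
      ≤-trans (≤-reflexive (sym term≡1))
              (≤-trans (≤-sumFin (term a b c p q r) w) (≤-Σ³ (λ p q r → sumFin (term a b c p q r)) p q r))
      where
      term≡1 : term a b c p q r w ≡ 1
      term≡1 = cong₂ _*_ ([]-T Qpqr)
        (trans (cong (λ t → δ³ t a b c) φ≡abc) (cong₂ _*_ (cong₂ _*_ (δ-refl a) (δ-refl b)) (δ-refl c)))

    covered : ∀ a b c → [ P a b c ] ≤ count a b c
    covered a b c with P a b c | cover a b c
    ... | false | _       = z≤n
    ... | true  | witness = counted (witness tt)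

module _ {n : ℕ} (H : CGH n) where

  Has-rotate : ∀ {x y z} → Has H x y z → Has H y z x
  Has-rotate (inj₁ p)                               = inj₂ (inj₂ (inj₂ (inj₂ (inj₁ p))))
  Has-rotate (inj₂ (inj₁ p))                        = inj₂ (inj₂ (inj₂ (inj₂ (inj₂ p))))
  Has-rotate (inj₂ (inj₂ (inj₁ p)))                 = inj₂ (inj₁ p)
  Has-rotate (inj₂ (inj₂ (inj₂ (inj₁ p))))          = inj₁ p
  Has-rotate (inj₂ (inj₂ (inj₂ (inj₂ (inj₁ p)))))   = inj₂ (inj₂ (inj₂ (inj₁ p)))
  Has-rotate (inj₂ (inj₂ (inj₂ (inj₂ (inj₂ p)))))   = inj₂ (inj₂ (inj₁ p))

  Has⇒T : ∀ {x y z} → x < y → y < z → Has H x y z → T (H x y z)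
  Has⇒T x<y y<z (inj₁ (_ , _ , t))                               = t
  Has⇒T x<y y<z (inj₂ (inj₁ (_ , z<y , _)))                      = ⊥-elim (<-asym y<z z<y)
  Has⇒T x<y y<z (inj₂ (inj₂ (inj₁ (y<x , _ , _))))               = ⊥-elim (<-asym x<y y<x)
  Has⇒T x<y y<z (inj₂ (inj₂ (inj₂ (inj₁ (_ , z<x , _)))))        = ⊥-elim (<-asym (<-trans x<y y<z) z<x)
  Has⇒T x<y y<z (inj₂ (inj₂ (inj₂ (inj₂ (inj₁ (z<x , _ , _)))))) = ⊥-elim (<-asym (<-trans x<y y<z) z<x)
  Has⇒T x<y y<z (inj₂ (inj₂ (inj₂ (inj₂ (inj₂ (z<y , _ , _)))))) = ⊥-elim (<-asym y<z z<y)

-- Sorting the image of u₀ < u₁ < u₂ < u₃ as a < b < c < d, the two edges of D1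
-- become {abc, acd} (even rotation) or {bcd, abd} (odd rotation).
SortedD1 : ∀ {n} → CGH n → Set
SortedD1 {n} H = ∃[ a ] ∃[ b ] ∃[ c ] ∃[ d ] a < b × b < c × c < d ×
  (T (H a b c) × T (H a c d) ⊎ T (H b c d) × T (H a b d))

ContainsD1⇒SortedD1 : ∀ {n} (H : CGH n) → ContainsD1 H → SortedD1 H
ContainsD1⇒SortedD1 H (f , inj₁ (p01 , p12 , p23) , h012 , h023) =
  f u0 , f u1 , f u2 , f u3 , p01 , p12 , p23 ,
  inj₁ (Has⇒T H p01 p12 h012 , Has⇒T H (<-trans p01 p12) p23 h023)
ContainsD1⇒SortedD1 H (f , inj₂ (inj₁ (p12 , p23 , p30)) , h012 , h023) =
  f u1 , f u2 , f u3 , f u0 , p12 , p23 , p30 ,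
  inj₂ (Has⇒T H p23 p30 (Has-rotate H h023) , Has⇒T H p12 (<-trans p23 p30) (Has-rotate H h012))
ContainsD1⇒SortedD1 H (f , inj₂ (inj₂ (inj₁ (p23 , p30 , p01))) , h012 , h023) =
  f u2 , f u3 , f u0 , f u1 , p23 , p30 , p01 ,
  inj₁ (Has⇒T H p23 p30 (Has-rotate H h023) ,
        Has⇒T H (<-trans p23 p30) p01 (Has-rotate H (Has-rotate H h012)))
ContainsD1⇒SortedD1 H (f , inj₂ (inj₂ (inj₂ (p30 , p01 , p12))) , h012 , h023) =
  f u3 , f u0 , f u1 , f u2 , p30 , p01 , p12 ,
  inj₂ (Has⇒T H p01 p12 h012 , Has⇒T H p30 (<-trans p01 p12) (Has-rotate H (Has-rotate H h023)))

SortedD1⇒ContainsD1 : ∀ {n} (H : CGH n) → SortedD1 H → ContainsD1 H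
SortedD1⇒ContainsD1 H (a , b , c , d , a<b , b<c , c<d , inj₁ (abc , acd)) =
  (a ∷ b ∷ c ∷ d ∷ []) , inj₁ (a<b , b<c , c<d) ,
  inj₁ (a<b , b<c , abc) , inj₁ (<-trans a<b b<c , c<d , acd)
SortedD1⇒ContainsD1 H (a , b , c , d , a<b , b<c , c<d , inj₂ (bcd , abd)) =
  (b ∷ c ∷ d ∷ a ∷ []) , inj₂ (inj₂ (inj₂ (a<b , b<c , c<d))) ,
  inj₁ (b<c , c<d , bcd) , Has-rotate H (inj₁ (a<b , <-trans b<c c<d , abd))

module _ {n : ℕ} (H : CGH n) (a b c : Fin n) where

  addEdge-old : ∀ {x y z} → T (H x y z) → T (addEdge H a b c x y z)
  addEdge-old old = Equivalence.from T-∨ (inj₁ old)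

  addEdge-new : T (addEdge H a b c a b c)
  addEdge-new rewrite isYes-true (a ≟ a) refl | isYes-true (b ≟ b) refl | isYes-true (c ≟ c) refl
                    | ∨-zeroʳ (H a b c) = tt

  addEdge-inv : ∀ {x y z} → T (addEdge H a b c x y z) → T (H x y z) ⊎ (x ≡ a × y ≡ b × z ≡ c)
  addEdge-inv t = Sum.map₂ new-edge (Equivalence.to T-∨ t)
    where
    new-edge : ∀ {x y z} → T (⌊ x ≟ a ⌋ ∧ ⌊ y ≟ b ⌋ ∧ ⌊ z ≟ c ⌋) → x ≡ a × y ≡ b × z ≡ c
    new-edge {x} {y} {z} t with Equivalence.to (T-∧ {⌊ x ≟ a ⌋}) t
    ... | x≡a , t′ with Equivalence.to (T-∧ {⌊ y ≟ b ⌋}) t′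
    ...   | y≡b , z≡c = toWitness {a? = x ≟ a} x≡a , toWitness {a? = y ≟ b} y≡b , toWitness {a? = z ≟ c} z≡c

module _ {n : ℕ} where

  -- For an edge pqr and a further vertex w, the triple on {p, q, r, w} that
  -- forms a sorted copy of D1 together with pqr.
  d1Partner : Fin n → Fin n → Fin n → Fin n → Triple n
  d1Partner p q r w =
    if ⌊ w <? p ⌋ then (w , p , r) else
    if ⌊ w <? q ⌋ then (p , w , q) else
    if ⌊ w <? r ⌋ then (q , w , r) else (p , r , w)

  d1Partner-w<p : ∀ {p q r w} → w < p → d1Partner p q r w ≡ (w , p , r)
  d1Partner-w<p {p} {w = w} w<p rewrite isYes-true (w <? p) w<p = refl

  d1Partner-p<w<q : ∀ {p q r w} → p < w → w < q → d1Partner p q r w ≡ (p , w , q)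
  d1Partner-p<w<q {p} {q} {w = w} p<w w<q
    rewrite isYes-false (w <? p) (<-asym p<w) | isYes-true (w <? q) w<q = refl

  d1Partner-q<w<r : ∀ {p q r w} → p < q → q < w → w < r → d1Partner p q r w ≡ (q , w , r)
  d1Partner-q<w<r {p} {q} {r} {w} p<q q<w w<r
    rewrite isYes-false (w <? p) (<-asym (<-trans p<q q<w)) | isYes-false (w <? q) (<-asym q<w)
          | isYes-true (w <? r) w<r = refl

  d1Partner-r<w : ∀ {p q r w} → p < q → q < r → r < w → d1Partner p q r w ≡ (p , r , w)
  d1Partner-r<w {p} {q} {r} {w} p<q q<r r<w
    rewrite isYes-false (w <? p) (<-asym (<-trans (<-trans p<q q<r) r<w))
          | isYes-false (w <? q) (<-asym (<-trans q<r r<w)) | isYes-false (w <? r) (<-asym r<w) = refl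

  saturated⇒nonEdge-d1Partner : (H : CGH n) → D1Saturated H →
    ∀ {a b c} → a < b → b < c → H a b c ≡ false →
    ∃[ p ] ∃[ q ] ∃[ r ] ∃[ w ] (p < q × q < r × T (H p q r)) × d1Partner p q r w ≡ (a , b , c)
  saturated⇒nonEdge-d1Partner H (D1-free , D1-saturated) {a} {b} {c} a<b b<c abc∉H =
    partner (ContainsD1⇒SortedD1 _ (D1-saturated a b c a<b b<c abc∉H))
    where
    partner : SortedD1 (addEdge H a b c) →
              ∃[ p ] ∃[ q ] ∃[ r ] ∃[ w ] (p < q × q < r × T (H p q r)) × d1Partner p q r w ≡ (a , b , c)
    partner (p , q , r , s , p<q , q<r , r<s , inj₁ (pqr , prs)) with addEdge-inv H a b c pqr | addEdge-inv H a b c prs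
    ... | inj₁ pqr∈H | inj₁ prs∈H =
      ⊥-elim (D1-free (SortedD1⇒ContainsD1 H (p , q , r , s , p<q , q<r , r<s , inj₁ (pqr∈H , prs∈H))))
    ... | inj₂ (refl , refl , refl) | inj₁ prs∈H =
      p , r , s , q , (<-trans p<q q<r , r<s , prs∈H) , d1Partner-p<w<q p<q q<r
    ... | inj₁ pqr∈H | inj₂ (refl , refl , refl) =
      p , q , r , s , (p<q , q<r , pqr∈H) , d1Partner-r<w p<q q<r r<s
    ... | inj₂ (_ , refl , _) | inj₂ (_ , refl , _) = ⊥-elim (<-irrefl refl q<r)
    partner (p , q , r , s , p<q , q<r , r<s , inj₂ (qrs , pqs)) with addEdge-inv H a b c qrs | addEdge-inv H a b c pqs
    ... | inj₁ qrs∈H | inj₁ pqs∈H =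
      ⊥-elim (D1-free (SortedD1⇒ContainsD1 H (p , q , r , s , p<q , q<r , r<s , inj₂ (qrs∈H , pqs∈H))))
    ... | inj₂ (refl , refl , refl) | inj₁ pqs∈H =
      p , q , s , r , (p<q , <-trans q<r r<s , pqs∈H) , d1Partner-q<w<r p<q q<r r<s
    ... | inj₁ qrs∈H | inj₂ (refl , refl , refl) =
      q , r , s , p , (q<r , r<s , qrs∈H) , d1Partner-w<p {q = r} {r = s} p<q
    ... | inj₂ (refl , _ , _) | inj₂ (refl , _ , _) = ⊥-elim (<-irrefl refl p<q)

-- Unlike ⌊ a <? b ⌋, the boolean toℕ a <ᵇ toℕ b computes on suc a and suc b, which the
-- recursions on n below rely on.
⌊<?⌋≡<ᵇ : ∀ {n} (a b : Fin n) → ⌊ a <? b ⌋ ≡ (toℕ a <ᵇ toℕ b)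
⌊<?⌋≡<ᵇ a b = isYes≗does (a <? b)

ascendingPairs : ℕ → ℕ
ascendingPairs n = sumFin {n} λ a → sumFin {n} λ b → [ toℕ a <ᵇ toℕ b ]

ascendingTriples : ℕ → ℕ
ascendingTriples n = Σ³ {n} λ a b c → [ (toℕ a <ᵇ toℕ b) ∧ (toℕ b <ᵇ toℕ c) ]

ascendingPairs-suc : ∀ n → ascendingPairs (suc n) ≡ n + ascendingPairs n
ascendingPairs-suc n = cong (_+ ascendingPairs n) (trans (sumFin-const n 1) (*-identityʳ n))

ascendingTriples-suc : ∀ n → ascendingTriples (suc n) ≡ ascendingPairs n + ascendingTriples n
ascendingTriples-suc n =
  cong₂ _+_ (cong (_+ ascendingPairs n) zeros)
            (sumFin-cong {n} λ a → cong₂ _+_ zeros (sumFin-cong {n} λ b →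
              cong (λ x → [ x ] + sumFin {n} λ c → [ (toℕ a <ᵇ toℕ b) ∧ (toℕ b <ᵇ toℕ c) ])
                   (∧-zeroʳ (toℕ a <ᵇ toℕ b))))
  where
  zeros : sumFin {suc n} (λ _ → 0) ≡ 0
  zeros = sumFin-zero {suc n} λ _ → refl

2*ascendingPairs : ∀ n → 2 * ascendingPairs n + n ≡ n * n
2*ascendingPairs zero    = refl
2*ascendingPairs (suc n) = begin
  2 * ascendingPairs (suc n) + suc n  ≡⟨ cong (λ x → 2 * x + suc n) (ascendingPairs-suc n) ⟩
  2 * (n + ascendingPairs n) + suc n  ≡⟨ regroup n (ascendingPairs n) ⟩
  (2 * ascendingPairs n + n) + 2 * n + 1 ≡⟨ cong (λ x → x + 2 * n + 1) (2*ascendingPairs n) ⟩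
  n * n + 2 * n + 1                   ≡⟨ square n ⟩
  suc n * suc n                       ∎
  where
  open ≡-Reasoning
  regroup : ∀ n x → 2 * (n + x) + suc n ≡ (2 * x + n) + 2 * n + 1
  regroup = solve-∀
  square : ∀ n → n * n + 2 * n + 1 ≡ suc n * suc n
  square = solve-∀

6*ascendingTriples : ∀ n → 6 * ascendingTriples n + 3 * (n * n) ≡ n * n * n + 2 * n
6*ascendingTriples zero    = refl
6*ascendingTriples (suc n) = begin
  6 * ascendingTriples (suc n) + 3 * (suc n * suc n)
    ≡⟨ cong (λ x → 6 * x + 3 * (suc n * suc n)) (ascendingTriples-suc n) ⟩
  6 * (P + T₃) + 3 * (suc n * suc n)
    ≡⟨ regroup n P T₃ ⟩
  3 * (2 * P + n) + (6 * T₃ + 3 * (n * n)) + 3 * n + 3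
    ≡⟨ cong₂ (λ x y → 3 * x + y + 3 * n + 3) (2*ascendingPairs n) (6*ascendingTriples n) ⟩
  3 * (n * n) + (n * n * n + 2 * n) + 3 * n + 3
    ≡⟨ cube n ⟩
  suc n * suc n * suc n + 2 * suc n ∎
  where
  open ≡-Reasoning
  P = ascendingPairs n
  T₃ = ascendingTriples n
  regroup : ∀ n x y → 6 * (x + y) + 3 * (suc n * suc n) ≡ 3 * (2 * x + n) + (6 * y + 3 * (n * n)) + 3 * n + 3
  regroup = solve-∀
  cube : ∀ n → 3 * (n * n) + (n * n * n + 2 * n) + 3 * n + 3 ≡ suc n * suc n * suc n + 2 * suc n
  cube = solve-∀

[]-split : ∀ x y h → [ x ∧ y ∧ h ] + [ x ∧ y ∧ not h ] ≡ [ x ∧ y ]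
[]-split false y     h     = refl
[]-split true  false h     = refl
[]-split true  true  false = refl
[]-split true  true  true  = refl

module _ {n : ℕ} (H : CGH n) where

  isEdge isNonEdge : Fin n → Fin n → Fin n → Bool
  isEdge    a b c = ⌊ a <? b ⌋ ∧ ⌊ b <? c ⌋ ∧ H a b c
  isNonEdge a b c = ⌊ a <? b ⌋ ∧ ⌊ b <? c ⌋ ∧ not (H a b c)

  isEdge-intro : ∀ {a b c} → a < b → b < c → T (H a b c) → T (isEdge a b c)
  isEdge-intro {a} {b} {c} a<b b<c abc∈H =
    Equivalence.from (T-∧ {⌊ a <? b ⌋})
      (fromWitness a<b , Equivalence.from (T-∧ {⌊ b <? c ⌋}) (fromWitness b<c , abc∈H))

  isNonEdge-elim : ∀ {a b c} → T (isNonEdge a b c) → a < b × b < c × H a b c ≡ false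
  isNonEdge-elim {a} {b} {c} t with Equivalence.to (T-∧ {⌊ a <? b ⌋}) t
  ... | a<b , t′ with Equivalence.to (T-∧ {⌊ b <? c ⌋}) t′
  ...   | b<c , abc∉H =
    toWitness {a? = a <? b} a<b , toWitness {a? = b <? c} b<c , Equivalence.to T-not-≡ abc∉H

  edgeCount+nonEdges : edgeCount H + Σ³ (λ a b c → [ isNonEdge a b c ]) ≡ ascendingTriples n
  edgeCount+nonEdges =
    trans (sym (Σ³-distrib-+ (λ a b c → [ isEdge a b c ]) (λ a b c → [ isNonEdge a b c ])))
          (Σ³-cong λ a b c → trans ([]-split ⌊ a <? b ⌋ ⌊ b <? c ⌋ (H a b c))
                                   (cong₂ (λ x y → [ x ∧ y ]) (⌊<?⌋≡<ᵇ a b) (⌊<?⌋≡<ᵇ b c)))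

  nonEdges-≤ : D1Saturated H → Σ³ (λ a b c → [ isNonEdge a b c ]) ≤ n * edgeCount H
  nonEdges-≤ saturated = Σ³-covered-≤ isNonEdge isEdge d1Partner λ a b c t →
    let a<b , b<c , abc∉H = isNonEdge-elim t
        p , q , r , w , (p<q , q<r , pqr∈H) , partner≡abc =
          saturated⇒nonEdge-d1Partner H saturated a<b b<c abc∉H
    in p , q , r , w , isEdge-intro p<q q<r pqr∈H , partner≡abc

  saturated⇒edgeCount-lowerBound : D1Saturated H → n * n ≤ 6 * edgeCount H + 4 * n
  saturated⇒edgeCount-lowerBound saturated = *-cancelʳ-≤ (n * n) (6 * e + 4 * n) (suc n) (begin
    n * n * suc n                                     ≡⟨ expand n ⟩
    n * n * n + n * n                                 ≤⟨ +-mono-≤ (m≤m+n (n * n * n) (2 * n)) ≤-refl ⟩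
    (n * n * n + 2 * n) + n * n                       ≡⟨ cong (_+ n * n) (6*ascendingTriples n) ⟨
    (6 * ascendingTriples n + 3 * (n * n)) + n * n    ≤⟨ +-mono-≤ (+-mono-≤ (*-monoʳ-≤ 6 triples≤) ≤-refl) ≤-refl ⟩
    (6 * (e + n * e) + 3 * (n * n)) + n * n           ≤⟨ m≤m+n _ (4 * n) ⟩
    (6 * (e + n * e) + 3 * (n * n)) + n * n + 4 * n   ≡⟨ factor n e ⟩
    (6 * e + 4 * n) * suc n                           ∎)
    where
    open ≤-Reasoning
    e = edgeCount H
    triples≤ : ascendingTriples n ≤ e + n * e
    triples≤ = begin
      ascendingTriples n                       ≡⟨ edgeCount+nonEdges ⟨
      e + Σ³ (λ a b c → [ isNonEdge a b c ])   ≤⟨ +-mono-≤ (≤-refl {e}) (nonEdges-≤ saturated) ⟩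
      e + n * e                                ∎
    expand : ∀ n → n * n * suc n ≡ n * n * n + n * n
    expand = solve-∀
    factor : ∀ n e → 6 * (e + n * e) + 3 * (n * n) + n * n + 4 * n ≡ (6 * e + 4 * n) * suc n
    factor = solve-∀

isPair : ℕ → ℕ → Bool
isPair zero          (suc zero)    = true
isPair (suc (suc x)) (suc (suc y)) = isPair x y
isPair _             _             = false

isPair⇒≡suc : ∀ x y → T (isPair x y) → y ≡ suc x
isPair⇒≡suc zero          (suc zero)          _  = refl
isPair⇒≡suc (suc (suc x)) (suc (suc y))       xy = cong (2 +_) (isPair⇒≡suc x y xy)
isPair⇒≡suc zero          zero                ()
isPair⇒≡suc zero          (suc (suc _))       ()
isPair⇒≡suc (suc zero)    _                   ()
isPair⇒≡suc (suc (suc _)) zero                ()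
isPair⇒≡suc (suc (suc _)) (suc zero)          ()

isPair-unchained : ∀ {x y z} → T (isPair x y) → ¬ T (isPair y z)
isPair-unchained {x} {y} {z} xy yz
  with refl ← isPair⇒≡suc x y xy | refl ← isPair⇒≡suc y z yz = noConsecutive x xy yz
  where
  noConsecutive : ∀ x → T (isPair x (suc x)) → ¬ T (isPair (suc x) (suc (suc x)))
  noConsecutive zero          _  ()
  noConsecutive (suc zero)    ()
  noConsecutive (suc (suc x)) = noConsecutive x

isPair-suc⊎pred : ∀ x → T (isPair x (suc x)) ⊎ ∃[ y ] x ≡ suc y × T (isPair y x)
isPair-suc⊎pred zero          = inj₁ tt
isPair-suc⊎pred (suc zero)    = inj₂ (0 , refl , tt)
isPair-suc⊎pred (suc (suc x)) =
  Sum.map₂ (λ (y , x≡1+y , yx) → suc (suc y) , cong (2 +_) x≡1+y , yx) (isPair-suc⊎pred x)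

pairTriples : ℕ → ℕ
pairTriples n = Σ³ {n} λ a b c → [ isPair (toℕ a) (toℕ b) ∧ (toℕ b <ᵇ toℕ c) ]

-- Vertices 0 and 1 lie exactly on the n edges {0, 1, c}.
pairTriples-2+ : ∀ n → pairTriples (2 + n) ≡ n + pairTriples n
pairTriples-2+ n = cong₂ _+_ first (cong₂ _+_ second rest)
  where
  zeros : ∀ m → sumFin {m} (λ _ → 0) ≡ 0
  zeros m = sumFin-zero {m} λ _ → refl

  first : sumFin {2 + n} (λ b → sumFin {2 + n} λ c → [ isPair 0 (toℕ b) ∧ (toℕ b <ᵇ toℕ c) ]) ≡ n
  first = begin
    sumFin {2 + n} (λ b → sumFin {2 + n} λ c → [ isPair 0 (toℕ b) ∧ (toℕ b <ᵇ toℕ c) ])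
      ≡⟨ cong₂ _+_ (zeros (2 + n)) (cong₂ _+_ (sumFin-const n 1) (sumFin-zero {n} λ _ → zeros (2 + n))) ⟩
    n * 1 + 0 ≡⟨ +-identityʳ (n * 1) ⟩
    n * 1     ≡⟨ *-identityʳ n ⟩
    n         ∎
    where open ≡-Reasoning

  second : sumFin {2 + n} (λ b → sumFin {2 + n} λ c → [ isPair 1 (toℕ b) ∧ (toℕ b <ᵇ toℕ c) ]) ≡ 0
  second = sumFin-zero {2 + n} λ _ → zeros (2 + n)

  rest : sumFin {n} (λ a → sumFin {2 + n} λ b → sumFin {2 + n} λ c →
           [ isPair (2 + toℕ a) (toℕ b) ∧ (toℕ b <ᵇ toℕ c) ]) ≡ pairTriples n
  rest = sumFin-cong {n} λ a → cong₂ _+_ (zeros (2 + n)) (cong₂ _+_ (zeros (2 + n)) (sumFin-cong {n} λ b →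
    let x = isPair (toℕ a) (toℕ b)
    in cong₂ _+_ (cong [_] (∧-zeroʳ x))
                 (cong (_+ sumFin {n} λ c → [ x ∧ (toℕ b <ᵇ toℕ c) ]) (cong [_] (∧-zeroʳ x)))))

4*pairTriples≤ : ∀ n → 4 * pairTriples n ≤ n * n
4*pairTriples≤ zero          = z≤n
4*pairTriples≤ (suc zero)    = z≤n
4*pairTriples≤ (suc (suc n)) = begin
  4 * pairTriples (2 + n)    ≡⟨ cong (4 *_) (pairTriples-2+ n) ⟩
  4 * (n + pairTriples n)    ≡⟨ distribute n (pairTriples n) ⟩
  4 * pairTriples n + 4 * n  ≤⟨ +-mono-≤ (≤-trans (4*pairTriples≤ n) (m≤m+n (n * n) 4)) ≤-refl ⟩
  (n * n + 4) + 4 * n        ≡⟨ square n ⟨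
  (2 + n) * (2 + n)          ∎
  where
  open ≤-Reasoning
  distribute : ∀ n x → 4 * (n + x) ≡ 4 * x + 4 * n
  distribute = solve-∀
  square : ∀ n → (2 + n) * (2 + n) ≡ (n * n + 4) + 4 * n
  square = solve-∀

pairCGH : ∀ {n} → CGH n
pairCGH a b c = isPair (toℕ a) (toℕ b)

isPair-absorbs-<ᵇ : ∀ x y z → ((x <ᵇ y) ∧ (y <ᵇ z) ∧ isPair x y) ≡ (isPair x y ∧ (y <ᵇ z))
isPair-absorbs-<ᵇ x y z with isPair x y in xy
... | false = trans (cong ((x <ᵇ y) ∧_) (∧-zeroʳ (y <ᵇ z))) (∧-zeroʳ (x <ᵇ y))
... | true with refl ← isPair⇒≡suc x y (Equivalence.from T-≡ xy)
  rewrite Equivalence.to T-≡ (<⇒<ᵇ (n<1+n x)) = ∧-identityʳ (suc x <ᵇ z)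

edgeCount-pairCGH : ∀ n → edgeCount (pairCGH {n}) ≡ pairTriples n
edgeCount-pairCGH n = Σ³-cong {n} λ a b c →
  trans (cong₂ (λ x y → [ x ∧ y ∧ pairCGH a b c ]) (⌊<?⌋≡<ᵇ a b) (⌊<?⌋≡<ᵇ b c))
        (cong [_] (isPair-absorbs-<ᵇ (toℕ a) (toℕ b) (toℕ c)))

4*edgeCount-pairCGH≤ : ∀ n → 4 * edgeCount (pairCGH {n}) ≤ n * n
4*edgeCount-pairCGH≤ n = subst (λ e → 4 * e ≤ n * n) (sym (edgeCount-pairCGH n)) (4*pairTriples≤ n)

vertexAt : ∀ {n k} → k ℕ.< n → Σ (Fin n) λ z → toℕ z ≡ k
vertexAt k<n = Fin.fromℕ< k<n , toℕ-fromℕ< k<n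

module _ {n : ℕ} where

  pairCGH-D1-free : ¬ SortedD1 (pairCGH {n})
  pairCGH-D1-free (a , b , c , _ , _ , b<c , _ , inj₁ (abc , acd)) =
    ℕ.<-irrefl (trans (isPair⇒≡suc (toℕ a) (toℕ b) abc) (sym (isPair⇒≡suc (toℕ a) (toℕ c) acd))) b<c
  pairCGH-D1-free (a , b , c , d , _ , _ , _ , inj₂ (bcd , abd)) =
    isPair-unchained {toℕ a} {toℕ b} {toℕ c} abd bcd

  -- A non-edge abc closes a copy of D1 with the edge {a, a+1, b} if a is even,
  -- and with the edge {a-1, a, c} if a is odd.
  pairCGH-completes : ∀ {a b c} → a < b → b < c → pairCGH a b c ≡ false →
                      SortedD1 (addEdge pairCGH a b c)
  pairCGH-completes {a} {b} {c} a<b b<c abc∉H with isPair-suc⊎pred (toℕ a)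
  ... | inj₁ a,1+a =
    a , z , b , c , a<z , z<b , b<c ,
    inj₁ (addEdge-old pairCGH a b c {a} {z} {b} azb∈H , addEdge-new pairCGH a b c)
    where
    1+a<b : suc (toℕ a) ℕ.< toℕ b
    1+a<b = ℕ.≤∧≢⇒< a<b λ 1+a≡b → subst T abc∉H (subst (λ k → T (isPair (toℕ a) k)) 1+a≡b a,1+a)
    z : Fin n
    z = proj₁ (vertexAt (ℕ.<-trans 1+a<b (toℕ<n b)))
    z≡1+a : toℕ z ≡ suc (toℕ a)
    z≡1+a = proj₂ (vertexAt (ℕ.<-trans 1+a<b (toℕ<n b)))
    a<z : a < z
    a<z = subst (toℕ a ℕ.<_) (sym z≡1+a) (n<1+n (toℕ a))
    z<b : z < b
    z<b = subst (ℕ._< toℕ b) (sym z≡1+a) 1+a<b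
    azb∈H : T (pairCGH a z b)
    azb∈H = subst (λ k → T (isPair (toℕ a) k)) (sym z≡1+a) a,1+a
  ... | inj₂ (y , a≡1+y , y,a) =
    z , a , b , c , z<a , a<b , b<c ,
    inj₂ (addEdge-new pairCGH a b c , addEdge-old pairCGH a b c {z} {a} {c} zac∈H)
    where
    y<a : y ℕ.< toℕ a
    y<a = subst (y ℕ.<_) (sym a≡1+y) (n<1+n y)
    z : Fin n
    z = proj₁ (vertexAt (ℕ.<-trans y<a (toℕ<n a)))
    z≡y : toℕ z ≡ y
    z≡y = proj₂ (vertexAt (ℕ.<-trans y<a (toℕ<n a)))
    z<a : z < a
    z<a = subst (ℕ._< toℕ a) (sym z≡y) y<a
    zac∈H : T (pairCGH z a c)
    zac∈H = subst (λ k → T (isPair k (toℕ a))) (sym z≡y) y,a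

  pairCGH-saturated : D1Saturated (pairCGH {n})
  pairCGH-saturated =
    pairCGH-D1-free ∘ ContainsD1⇒SortedD1 pairCGH ,
    λ a b c a<b b<c abc∉H → SortedD1⇒ContainsD1 _ (pairCGH-completes a<b b<c abc∉H)

-- Without function extensionality, functions Fin n → A can only be searched for
-- predicates that respect pointwise equality.
Exhaustible : Setoid 0ℓ 0ℓ → Set₁
Exhaustible S = ∀ {P : Pred (Setoid.Carrier S) 0ℓ} → P Respects Setoid._≈_ S → U.Decidable P → Dec (∃ P)

Bool-exhaustible : Exhaustible (≡.setoid Bool)
Bool-exhaustible {P} _ P? with P? true | P? false
... | yes p  | _      = yes (true , p)
... | no _   | yes p  = yes (false , p)
... | no ¬pt | no ¬pf = no λ { (true , p) → ¬pt p ; (false , p) → ¬pf p }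

Vector-exhaustible : ∀ S → Exhaustible S → ∀ n → Exhaustible (Pointwise.setoid S n)
Vector-exhaustible S search zero    resp P? = map′ ([] ,_) (λ (v , p) → resp (λ ()) p) (P? [])
Vector-exhaustible S search (suc n) {P} resp P? =
  map′ (λ (x , xs , p) → x ∷ xs , p) (λ (v , p) → head v , tail v , resp cons-head-tail p)
       (search resp-head λ x → Vector-exhaustible S search n (resp-tail x) (P? ∘ (x ∷_)))
  where
  open Setoid S using (_≈_) renaming (refl to ≈-refl)
  cons-head-tail : ∀ {v} → Pointwise _≈_ v (head v ∷ tail v)
  cons-head-tail zero    = ≈-refl
  cons-head-tail (suc i) = ≈-refl
  resp-head : (λ x → ∃ λ xs → P (x ∷ xs)) Respects _≈_
  resp-head x≈y (xs , p) = xs , resp (λ { zero → x≈y ; (suc i) → ≈-refl }) p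
  resp-tail : ∀ x → (λ xs → P (x ∷ xs)) Respects Pointwise _≈_
  resp-tail x xs≋ys = resp λ { zero → ≈-refl ; (suc i) → xs≋ys i }

CGH-setoid : ℕ → Setoid 0ℓ 0ℓ
CGH-setoid n = Pointwise.setoid (Pointwise.setoid (Pointwise.setoid (≡.setoid Bool) n) n) n

CGH-exhaustible : ∀ n → Exhaustible (CGH-setoid n)
CGH-exhaustible n =
  Vector-exhaustible S₂ (Vector-exhaustible S₁ (Vector-exhaustible S₀ Bool-exhaustible n) n) n
  where
  S₀ S₁ S₂ : Setoid 0ℓ 0ℓ
  S₀ = ≡.setoid Bool
  S₁ = Pointwise.setoid S₀ n
  S₂ = Pointwise.setoid S₁ n

module _ {n : ℕ} where

  open Setoid (CGH-setoid n) using (_≈_) renaming (sym to ≈-sym)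

  SortedD1-resp : SortedD1 Respects _≈_
  SortedD1-resp H≈H′ (a , b , c , d , a<b , b<c , c<d , inj₁ (abc , acd)) =
    a , b , c , d , a<b , b<c , c<d , inj₁ (subst T (H≈H′ a b c) abc , subst T (H≈H′ a c d) acd)
  SortedD1-resp H≈H′ (a , b , c , d , a<b , b<c , c<d , inj₂ (bcd , abd)) =
    a , b , c , d , a<b , b<c , c<d , inj₂ (subst T (H≈H′ b c d) bcd , subst T (H≈H′ a b d) abd)

  ContainsD1-resp : ContainsD1 Respects _≈_
  ContainsD1-resp H≈H′ = SortedD1⇒ContainsD1 _ ∘ SortedD1-resp H≈H′ ∘ ContainsD1⇒SortedD1 _

  addEdge-resp : ∀ {H H′} → H ≈ H′ → ∀ a b c → addEdge H a b c ≈ addEdge H′ a b c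
  addEdge-resp H≈H′ a b c x y z = cong (_∨ _) (H≈H′ x y z)

  D1Saturated-resp : D1Saturated Respects _≈_
  D1Saturated-resp H≈H′ (D1-free , D1-saturated) =
    D1-free ∘ ContainsD1-resp (≈-sym H≈H′) ,
    λ a b c a<b b<c abc∉H′ →
      ContainsD1-resp (addEdge-resp H≈H′ a b c) (D1-saturated a b c a<b b<c (trans (H≈H′ a b c) abc∉H′))

  edgeCount-resp : ∀ {H H′} → H ≈ H′ → edgeCount H ≡ edgeCount H′
  edgeCount-resp H≈H′ = Σ³-cong λ a b c → cong (λ h → [ ⌊ a <? b ⌋ ∧ ⌊ b <? c ⌋ ∧ h ]) (H≈H′ a b c)

  sortedD1? : U.Decidable (SortedD1 {n})
  sortedD1? H = any? λ a → any? λ b → any? λ c → any? λ d →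
    a <? b ×-dec b <? c ×-dec c <? d ×-dec
    (T? (H a b c) ×-dec T? (H a c d) ⊎-dec T? (H b c d) ×-dec T? (H a b d))

  containsD1? : U.Decidable (ContainsD1 {n})
  containsD1? H = map′ (SortedD1⇒ContainsD1 H) (ContainsD1⇒SortedD1 H) (sortedD1? H)

  d1Saturated? : U.Decidable (D1Saturated {n})
  d1Saturated? H = ¬? (containsD1? H) ×-dec all? λ a → all? λ b → all? λ c →
    a <? b →-dec b <? c →-dec H a b c Bool.≟ false →-dec containsD1? (addEdge H a b c)

least-witness : (Q : ℕ → Set) → U.Decidable Q → ∀ {m} → Q m → ∃[ k ] Q k × (∀ {j} → Q j → k ≤ j)
least-witness Q Q? {zero}  Q0 = 0 , Q0 , λ _ → z≤n
least-witness Q Q? {suc m} Qm with Q? 0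
... | yes Q0 = 0 , Q0 , λ _ → z≤n
... | no ¬Q0 =
  let k , Q1+k , least = least-witness (Q ∘ suc) (Q? ∘ suc) Qm
  in suc k , Q1+k , λ { {zero} Q0 → ⊥-elim (¬Q0 Q0) ; {suc j} Q1+j → s≤s (least Q1+j) }

satD1-exists : ∀ n (H₀ : CGH n) → D1Saturated H₀ → ∃[ s ] IsSatD1 n s × s ≤ edgeCount H₀
satD1-exists n H₀ saturated₀ =
  let k , (H , saturated , count≤k) , least = least-witness Attainable attainable? (H₀ , saturated₀ , ≤-refl)
      minimal : ∀ {H′} → D1Saturated H′ → edgeCount H ≤ edgeCount H′
      minimal saturated′ = ≤-trans count≤k (least (_ , saturated′ , ≤-refl))
  in edgeCount H , ((H , saturated , refl) , λ _ → minimal) , minimal saturated₀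
  where
  Attainable : ℕ → Set
  Attainable k = ∃[ H ] D1Saturated H × edgeCount H ≤ k
  attainable? : U.Decidable Attainable
  attainable? k = CGH-exhaustible n
    (λ H≈H′ (saturated , count≤k) → D1Saturated-resp H≈H′ saturated , subst (_≤ k) (edgeCount-resp H≈H′) count≤k)
    (λ H → d1Saturated? H ×-dec edgeCount H ℕ.≤? k)

proposition4p13 : ∃[ C ] ∃[ N ] ∀ (n : ℕ) → N ≤ n →
    Σ ℕ λ s → IsSatD1 n s × (n * n ≤ 6 * s + C * n) × (4 * s ≤ n * n + C * n)
proposition4p13 = 4 , 0 , λ n _ →
  let s , isSat , s≤pairCount = satD1-exists n pairCGH (pairCGH-saturated {n})
      (H , saturated , count≡s) , _ = isSat
  in s , isSat ,
     subst (λ e → n * n ≤ 6 * e + 4 * n) count≡s (saturated⇒edgeCount-lowerBound H saturated) ,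
     ≤-trans (*-monoʳ-≤ 4 s≤pairCount) (≤-trans (4*edgeCount-pairCGH≤ n) (m≤m+n (n * n) (4 * n)))
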